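{- Let $F$ be a non-empty rooted forest. Then $S_F$ is irreducible in $\mathbb Z[x,y]$ if and only if $F$ is a tree.
   Context: A rooted forest is a finite, possibly empty, disjoint union of rooted trees (finite trees with a distinguished root). For a rooted tree $T$, a subtree is either the empty subgraph or a connected subgraph containing the root, identified with its vertex set. For a vertex set $S$, $\partial S$ is the set of vertices adjacent to a vertex of $S$ but not in $S$, with $\partial\emptyset=\{\text{root}\}$. $S_T(x,y)=\sum_{T'}x^{|T'|}y^{|\partial T'|}$ over all subtrees $T'$ of $T$. For a rooted forest $F$ with components $T_1,\dots,T_r$, $S_F:=\prod_{i=1}^r S_{T_i}$. -}

module Defs where

open import Data.Nat as ℕ using (ℕ; zero; suc; _∸_; _≤_)
open import Data.Integer as ℤ using (ℤ; 0ℤ; 1ℤ)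
open import Data.List using (List; []; _∷_; concatMap; map; foldr)
open import Data.List.Relation.Unary.All using (All; []; _∷_)
open import Data.Product using (Σ; ∃; _×_; _,_)
open import Data.Sum using (_⊎_)
open import Relation.Binary.PropositionalEquality using (_≡_)
open import Relation.Nullary using (¬_; yes; no)

-- Bivariate integer polynomials  ℤ[x,y]
-- A polynomial is given by its coefficient function  (i , j) ↦ [x^i y^j] p
-- together with finiteness of its support (the predicate IsPoly).

Coeffs : Set
Coeffs = ℕ → ℕ → ℤ

IsPoly : Coeffs → Set
IsPoly p = Σ ℕ λ N → ∀ i j → (N ≤ i ⊎ N ≤ j) → p i j ≡ 0ℤ

_≈P_ : Coeffs → Coeffs → Set
p ≈P q = ∀ i j → p i j ≡ q i j

zeroP : Coeffs
zeroP _ _ = 0ℤ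

mono : ℕ → ℕ → Coeffs
mono a b i j with i ℕ.≟ a | j ℕ.≟ b
... | yes _ | yes _ = 1ℤ
... | _     | _     = 0ℤ

oneP : Coeffs
oneP = mono 0 0

_+P_ : Coeffs → Coeffs → Coeffs
(p +P q) i j = p i j ℤ.+ q i j

sumTo : ℕ → (ℕ → ℤ) → ℤ
sumTo zero    f = f 0
sumTo (suc n) f = sumTo n f ℤ.+ f (suc n)

_*P_ : Coeffs → Coeffs → Coeffs
(p *P q) i j = sumTo i λ a → sumTo j λ b → p a b ℤ.* q (i ∸ a) (j ∸ b)

IsUnit : Coeffs → Set
IsUnit p = Σ Coeffs λ u → IsPoly u × ((p *P u) ≈P oneP)

record Irreducible (p : Coeffs) : Set₁ where
  field
    nonzero  : ¬ (p ≈P zeroP)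
    nonunit  : ¬ IsUnit p
    split    : ∀ a b → IsPoly a → IsPoly b → p ≈P (a *P b) → IsUnit a ⊎ IsUnit b

data Tree : Set where
  node : List Tree → Tree

Forest : Set
Forest = List Tree

-- Subtrees of a rooted tree T (empty, or a connected vertex set containing
-- the root).
data Sub : Tree → Set
data Subs : List Tree → Set

data Sub where
  empty : ∀ {t} → Sub t
  root  : ∀ {ts} → Subs ts → Sub (node ts)

data Subs where
  []  : Subs []
  _∷_ : ∀ {t ts} → Sub t → Subs ts → Subs (t ∷ ts)

size  : ∀ {t} → Sub t → ℕ
sizes : ∀ {ts} → Subs ts → ℕ
size empty    = 0
size (root s) = suc (sizes s)
sizes []       = 0
sizes (s ∷ ss) = size s ℕ.+ sizes ss

-- ∂∅ = {root}; for a nonempty subtree the boundary consists of the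
-- boundaries inside the child subtrees (a child c with empty subtree
-- contributes its root c).
bnd  : ∀ {t} → Sub t → ℕ
bnds : ∀ {ts} → Subs ts → ℕ
bnd empty    = 1
bnd (root s) = bnds s
bnds []       = 0
bnds (s ∷ ss) = bnd s ℕ.+ bnds ss

allSub  : (t : Tree) → List (Sub t)
allSubs : (ts : List Tree) → List (Subs ts)
allSub (node ts) = empty ∷ map root (allSubs ts)
allSubs []       = [] ∷ []
allSubs (t ∷ ts) = concatMap (λ s → map (s ∷_) (allSubs ts)) (allSub t)

S-tree : Tree → Coeffs
S-tree t = foldr (λ s acc → mono (size s) (bnd s) +P acc) zeroP (allSub t)

S-forest : Forest → Coeffs
S-forest = foldr (λ t acc → S-tree t *P acc) oneP

-- For a forest with at least two trees, S_F is a product of two polynomials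
-- with vanishing constant term, neither of which is a unit.
--
-- For a tree T with n vertices, P = S_T has the following shape: P(x,0) = xⁿ
-- (only T itself has empty boundary), P has x-degree n, its xⁿ-coefficient
-- does not involve y, and the coefficient of y is 1 (the empty subtree).
-- Suppose P = A B.  Comparing the y-coefficients, A(0,0) B(0,1) + A(0,1) B(0,0)
-- = 1, so say A(0,0) ≠ 0.  Reading P(x,0) = A(x,0) B(x,0) from the lowest
-- power of x upward shows that B(x,0) has a nonzero xⁿ-term, so B has
-- x-degree at least n.  Multiplying the lexicographically leading terms of A
-- and B, with x-degree compared first, shows A has x-degree 0 and then that
-- A has y-degree 0.  So A is a constant dividing 1.
module Submission where

open import Defs
open import Data.Empty using (⊥-elim)
open import Data.Integer as ℤ using (ℤ; 0ℤ; 1ℤ; +_; -[1+_])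
import Data.Integer.Properties as ℤP
open import Data.List using (List; []; _∷_; map; concatMap; foldr; length)
open import Data.List.Relation.Unary.Any as Any using (Any; here; there; satisfied)
import Data.List.Relation.Unary.Any.Properties as AnyP
open import Data.Nat as ℕ using (ℕ; zero; suc; _+_; _∸_; _≤_; _<_; z≤n; s≤s; s≤s⁻¹; z<s)
open import Data.Nat.Induction using (<-rec)
open import Data.Nat.Properties
open import Data.Product using (∃; ∃₂; _×_; _,_; proj₁; proj₂)
open import Data.Product.Relation.Binary.Lex.Strict using (×-Lex)
open import Data.Sum using (_⊎_; inj₁; inj₂; [_,_]′) renaming (map to ⊎-map)
open import Function using (_∘_; id; case_of_)
open import Function.Bundles using (_⇔_; mk⇔)
open import Relation.Binary.Definitions using (tri<; tri≈; tri>)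
open import Relation.Binary.PropositionalEquality
open import Relation.Nullary using (¬_; yes; no)
open import Relation.Nullary.Decidable using (decidable-stable; ¬?)
open import Relation.Unary using (Decidable)

open ≡-Reasoning

*-vanishˡ : ∀ {x} y → x ≡ 0ℤ → x ℤ.* y ≡ 0ℤ
*-vanishˡ y refl = refl

*-vanishʳ : ∀ x {y} → y ≡ 0ℤ → x ℤ.* y ≡ 0ℤ
*-vanishʳ x refl = ℤP.*-zeroʳ x

*-≢0 : ∀ {x y} → x ≢ 0ℤ → y ≢ 0ℤ → x ℤ.* y ≢ 0ℤ
*-≢0 {x} x≢0 y≢0 xy≡0 = [ x≢0 , y≢0 ]′ (ℤP.i*j≡0⇒i≡0∨j≡0 x xy≡0)

*-cancelˡ-≡0 : ∀ {x y} → x ≢ 0ℤ → x ℤ.* y ≡ 0ℤ → y ≡ 0ℤ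
*-cancelˡ-≡0 {x} x≢0 xy≡0 = [ ⊥-elim ∘ x≢0 , id ]′ (ℤP.i*j≡0⇒i≡0∨j≡0 x xy≡0)

∣i∣≡1⇒i*i≡1 : ∀ i → ℤ.∣ i ∣ ≡ 1 → i ℤ.* i ≡ 1ℤ
∣i∣≡1⇒i*i≡1 (+ 1)           _ = refl
∣i∣≡1⇒i*i≡1 -[1+ 0 ]        _ = refl
∣i∣≡1⇒i*i≡1 (+ 0)           ()
∣i∣≡1⇒i*i≡1 (+ suc (suc _)) ()
∣i∣≡1⇒i*i≡1 -[1+ suc _ ]    ()

¬a≢a⊎b≢b : ∀ {A : Set} {a b : A} → ¬ (a ≢ a ⊎ b ≢ b)
¬a≢a⊎b≢b = [ (λ a≢a → a≢a refl) , (λ b≢b → b≢b refl) ]′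

<⇒<+∸ : ∀ {a d} e → a < d → e < d + e ∸ a
<⇒<+∸ e a<d = subst (e <_) (sym (+-∸-comm e (<⇒≤ a<d))) (+-monoˡ-< e (m<n⇒0<n∸m a<d))

+≡+⇒≡ : ∀ {a b c d} → a ≤ c → b ≤ d → a + b ≡ c + d → a ≡ c × b ≡ d
+≡+⇒≡ {a} a≤c b≤d eq with m≤n⇒m<n∨m≡n a≤c
... | inj₁ a<c  = ⊥-elim (<-irrefl eq (+-mono-<-≤ a<c b≤d))
... | inj₂ refl = refl , +-cancelˡ-≡ a _ _ eq

greatest : ∀ {P : ℕ → Set} → Decidable P → ∀ N → (∀ {i} → P i → i < N)
         → ∀ {i} → P i → ∃ λ m → P m × (∀ {k} → P k → k ≤ m)
greatest P? zero    bound Pi = ⊥-elim (n≮0 (bound Pi))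
greatest P? (suc N) bound Pi with P? N
... | yes PN = N , PN , s≤s⁻¹ ∘ bound
... | no ¬PN = greatest P? N (λ Pk → ≤∧≢⇒< (s≤s⁻¹ (bound Pk)) λ { refl → ¬PN Pk }) Pi

sumTo-cong : ∀ n {f g : ℕ → ℤ} → (∀ k → k ≤ n → f k ≡ g k) → sumTo n f ≡ sumTo n g
sumTo-cong zero    f≗g = f≗g 0 z≤n
sumTo-cong (suc n) f≗g =
  cong₂ ℤ._+_ (sumTo-cong n λ k k≤n → f≗g k (m≤n⇒m≤1+n k≤n)) (f≗g (suc n) ≤-refl)

sumTo-zero : ∀ n (f : ℕ → ℤ) → (∀ k → k ≤ n → f k ≡ 0ℤ) → sumTo n f ≡ 0ℤ
sumTo-zero zero    f f≡0 = f≡0 0 z≤n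
sumTo-zero (suc n) f f≡0 =
  cong₂ ℤ._+_ (sumTo-zero n f λ k k≤n → f≡0 k (m≤n⇒m≤1+n k≤n)) (f≡0 (suc n) ≤-refl)

sumTo-single : ∀ n (f : ℕ → ℤ) m → m ≤ n → (∀ k → k ≤ n → k ≢ m → f k ≡ 0ℤ)
             → sumTo n f ≡ f m
sumTo-single zero    f .zero z≤n _ = refl
sumTo-single (suc n) f m m≤1+n f≡0 with m ≟ suc n
... | yes refl = begin
  sumTo n f ℤ.+ f (suc n) ≡⟨ cong (ℤ._+ f (suc n)) (sumTo-zero n f λ k k≤n →
                              f≡0 k (m≤n⇒m≤1+n k≤n) (<⇒≢ (s≤s k≤n))) ⟩
  0ℤ ℤ.+ f (suc n)        ≡⟨ ℤP.+-identityˡ _ ⟩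
  f (suc n)               ∎
... | no m≢1+n = begin
  sumTo n f ℤ.+ f (suc n) ≡⟨ cong₂ ℤ._+_ (sumTo-single n f m m≤n λ k k≤n →
                                            f≡0 k (m≤n⇒m≤1+n k≤n))
                                         (f≡0 (suc n) ≤-refl (m≢1+n ∘ sym)) ⟩
  f m ℤ.+ 0ℤ              ≡⟨ ℤP.+-identityʳ _ ⟩
  f m                     ∎
  where m≤n = s≤s⁻¹ (≤∧≢⇒< m≤1+n m≢1+n)

sumTo-unfoldˡ : ∀ n f → sumTo (suc n) f ≡ f 0 ℤ.+ sumTo n (f ∘ suc)
sumTo-unfoldˡ zero    f = refl
sumTo-unfoldˡ (suc n) f =
  trans (cong (ℤ._+ f (suc (suc n))) (sumTo-unfoldˡ n f)) (ℤP.+-assoc (f 0) _ _)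

sumTo-reverse : ∀ n f → sumTo n f ≡ sumTo n (λ k → f (n ∸ k))
sumTo-reverse zero    f = refl
sumTo-reverse (suc n) f = begin
  sumTo n f ℤ.+ f (suc n)                   ≡⟨ cong (ℤ._+ f (suc n)) (sumTo-reverse n f) ⟩
  sumTo n (λ k → f (n ∸ k)) ℤ.+ f (suc n)   ≡⟨ ℤP.+-comm _ (f (suc n)) ⟩
  f (suc n) ℤ.+ sumTo n (λ k → f (n ∸ k))   ≡⟨ sumTo-unfoldˡ n (λ k → f (suc n ∸ k)) ⟨
  sumTo (suc n) (λ k → f (suc n ∸ k))       ∎

*P-single-term : ∀ (X Y : Coeffs) i j a₀ b₀ → a₀ ≤ i → b₀ ≤ j
  → (∀ a b → a ≤ i → b ≤ j → (a ≢ a₀ ⊎ b ≢ b₀) → X a b ℤ.* Y (i ∸ a) (j ∸ b) ≡ 0ℤ)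
  → (X *P Y) i j ≡ X a₀ b₀ ℤ.* Y (i ∸ a₀) (j ∸ b₀)
*P-single-term X Y i j a₀ b₀ a₀≤i b₀≤j others≡0 =
  trans (sumTo-single i _ a₀ a₀≤i λ a a≤i a≢a₀ →
           sumTo-zero j _ λ b b≤j → others≡0 a b a≤i b≤j (inj₁ a≢a₀))
        (sumTo-single j _ b₀ b₀≤j λ b b≤j b≢b₀ → others≡0 a₀ b a₀≤i b≤j (inj₂ b≢b₀))

*P-comm : ∀ X Y → (X *P Y) ≈P (Y *P X)
*P-comm X Y i j = begin
  sumTo i (λ a → sumTo j λ b → X a b ℤ.* Y (i ∸ a) (j ∸ b))
    ≡⟨ sumTo-reverse i _ ⟩
  sumTo i (λ a → sumTo j λ b → X (i ∸ a) b ℤ.* Y (i ∸ (i ∸ a)) (j ∸ b))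
    ≡⟨ sumTo-cong i (λ a _ → sumTo-reverse j _) ⟩
  sumTo i (λ a → sumTo j λ b → X (i ∸ a) (j ∸ b) ℤ.* Y (i ∸ (i ∸ a)) (j ∸ (j ∸ b)))
    ≡⟨ sumTo-cong i (λ a a≤i → sumTo-cong j λ b b≤j → swap a≤i b≤j) ⟩
  (Y *P X) i j
    ∎
  where
  swap : ∀ {a b} → a ≤ i → b ≤ j
       → X (i ∸ a) (j ∸ b) ℤ.* Y (i ∸ (i ∸ a)) (j ∸ (j ∸ b)) ≡ Y a b ℤ.* X (i ∸ a) (j ∸ b)
  swap {a} {b} a≤i b≤j = trans (ℤP.*-comm (X (i ∸ a) (j ∸ b)) _)
    (cong₂ (λ u v → Y u v ℤ.* X (i ∸ a) (j ∸ b)) (m∸[m∸n]≡n a≤i) (m∸[m∸n]≡n b≤j))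

Constant : Coeffs → Set
Constant X = ∀ a b → (a ≢ 0 ⊎ b ≢ 0) → X a b ≡ 0ℤ

oneP-constant : Constant oneP
oneP-constant zero    zero    00≢00 = ⊥-elim (¬a≢a⊎b≢b 00≢00)
oneP-constant zero    (suc b) _          = refl
oneP-constant (suc a) b       _          = refl

*P-constantˡ : ∀ {X} → Constant X → ∀ Y → (X *P Y) ≈P (λ i j → X 0 0 ℤ.* Y i j)
*P-constantˡ {X} X-const Y i j =
  *P-single-term X Y i j 0 0 z≤n z≤n λ a b _ _ ab≢00 → *-vanishˡ (Y (i ∸ a) (j ∸ b)) (X-const a b ab≢00)

*P-identityʳ : ∀ X → (X *P oneP) ≈P X
*P-identityʳ X i j =
  trans (*P-comm X oneP i j) (trans (*P-constantˡ oneP-constant X i j) (ℤP.*-identityˡ (X i j)))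

support-bound : ∀ {X} ((N , X≡0) : IsPoly X) → ∀ {a b} → X a b ≢ 0ℤ → a < N × b < N
support-bound (N , X≡0) Xab≢0 =
  ≰⇒> (λ N≤a → Xab≢0 (X≡0 _ _ (inj₁ N≤a))) , ≰⇒> (λ N≤b → Xab≢0 (X≡0 _ _ (inj₂ N≤b)))

*P-isPoly : ∀ {X Y} → IsPoly X → IsPoly Y → IsPoly (X *P Y)
*P-isPoly {X} {Y} (N₁ , X≡0) (N₂ , Y≡0) =
  N₁ + N₂ , λ i j out → sumTo-zero i _ λ a _ → sumTo-zero j _ λ b _ → term a b out
  where
  split : ∀ {i} a → N₁ + N₂ ≤ i → N₁ ≤ a ⊎ N₂ ≤ i ∸ a
  split a N≤i with N₁ ≤? a
  ... | yes N₁≤a = inj₁ N₁≤a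
  ... | no  N₁≰a = inj₂ (m+n≤o⇒m≤o∸n N₂ (≤-trans (≤-reflexive (+-comm N₂ a))
                           (≤-trans (+-monoˡ-≤ N₂ (<⇒≤ (≰⇒> N₁≰a))) N≤i)))
  term : ∀ {i j} a b → (N₁ + N₂ ≤ i ⊎ N₁ + N₂ ≤ j) → X a b ℤ.* Y (i ∸ a) (j ∸ b) ≡ 0ℤ
  term {i} {j} a b (inj₁ N≤i) =
    [ (λ N₁≤a → *-vanishˡ (Y (i ∸ a) (j ∸ b)) (X≡0 a b (inj₁ N₁≤a)))
    , (λ N₂≤i∸a → *-vanishʳ (X a b) (Y≡0 _ _ (inj₁ N₂≤i∸a))) ]′ (split a N≤i)
  term {i} {j} a b (inj₂ N≤j) =
    [ (λ N₁≤b → *-vanishˡ (Y (i ∸ a) (j ∸ b)) (X≡0 a b (inj₂ N₁≤b)))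
    , (λ N₂≤j∸b → *-vanishʳ (X a b) (Y≡0 _ _ (inj₂ N₂≤j∸b))) ]′ (split b N≤j)

zero-constant⇒¬unit : ∀ {X} → X 0 0 ≡ 0ℤ → ¬ IsUnit X
zero-constant⇒¬unit X00≡0 (U , _ , XU≈1) with trans (sym (*-vanishˡ (U 0 0) X00≡0)) (XU≈1 0 0)
... | ()

constant-unit : ∀ {X} → IsPoly X → Constant X → ℤ.∣ X 0 0 ∣ ≡ 1 → IsUnit X
constant-unit {X} X-poly X-const ∣X00∣≡1 =
  X , X-poly , λ i j → trans (*P-constantˡ X-const X i j) (inverse i j)
  where
  inverse : ∀ i j → X 0 0 ℤ.* X i j ≡ oneP i j
  inverse zero    zero    = ∣i∣≡1⇒i*i≡1 (X 0 0) ∣X00∣≡1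
  inverse zero    (suc j) = *-vanishʳ (X 0 0) (X-const 0 (suc j) (inj₂ λ ()))
  inverse (suc i) j       = *-vanishʳ (X 0 0) (X-const (suc i) j (inj₁ λ ()))

_<ₗₑₓ_ : ℕ × ℕ → ℕ × ℕ → Set
_<ₗₑₓ_ = ×-Lex _≡_ _<_ _<_

lex-split : ∀ {d p e q a b} → (a ≢ d ⊎ b ≢ p)
          → (d , p) <ₗₑₓ (a , b) ⊎ (e , q) <ₗₑₓ (d + e ∸ a , p + q ∸ b)
lex-split {d} {p} {e} {q} {a} {b} ab≢dp with <-cmp a d
... | tri> _ _ d<a  = inj₁ (inj₁ d<a)
... | tri< a<d _ _  = inj₂ (inj₁ (<⇒<+∸ e a<d))
... | tri≈ _ refl _ with <-cmp b p
...   | tri> _ _ p<b  = inj₁ (inj₂ (refl , p<b))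
...   | tri< b<p _ _  = inj₂ (inj₂ (sym (m+n∸m≡n a e) , <⇒<+∸ q b<p))
...   | tri≈ _ refl _ = ⊥-elim (¬a≢a⊎b≢b ab≢dp)

record LexLeading (X : Coeffs) (d p : ℕ) : Set where
  field
    nonzero  : X d p ≢ 0ℤ
    vanishes : ∀ a b → (d , p) <ₗₑₓ (a , b) → X a b ≡ 0ℤ

open LexLeading

lexLeading-exists : ∀ {X a b} → IsPoly X → X a b ≢ 0ℤ → ∃₂ (LexLeading X)
lexLeading-exists {X} X-poly@(N , _) Xab≢0 =
  leading (greatest row? N (λ (_ , Xab≢0) → proj₁ (support-bound X-poly Xab≢0)) (_ , Xab≢0))
  where
  Row : ℕ → Set
  Row a = ∃ λ b → X a b ≢ 0ℤ
  row? : Decidable Row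
  row? a with anyUpTo? (λ b → ¬? (X a b ℤ.≟ 0ℤ)) N
  ... | yes (b , _ , Xab≢0) = yes (b , Xab≢0)
  ... | no  none            = no λ (b , Xab≢0) → none (b , proj₂ (support-bound X-poly Xab≢0) , Xab≢0)
  leading : (∃ λ d → Row d × ∀ {k} → Row k → k ≤ d) → ∃₂ (LexLeading X)
  leading (d , (_ , Xdb≢0) , rowMax)
    with greatest (λ b → ¬? (X d b ℤ.≟ 0ℤ)) N (proj₂ ∘ support-bound X-poly) Xdb≢0
  ... | p , Xdp≢0 , colMax = d , p , record { nonzero = Xdp≢0 ; vanishes = vanish }
    where
    vanish : ∀ a b → (d , p) <ₗₑₓ (a , b) → X a b ≡ 0ℤ
    vanish a b (inj₁ d<a) =
      decidable-stable (X a b ℤ.≟ 0ℤ) λ Xab≢0 → <⇒≱ d<a (rowMax (b , Xab≢0))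
    vanish a b (inj₂ (refl , p<b)) =
      decidable-stable (X a b ℤ.≟ 0ℤ) λ Xab≢0 → <⇒≱ p<b (colMax Xab≢0)

*P-lexLeading : ∀ {X Y d p e q} → LexLeading X d p → LexLeading Y e q
              → (X *P Y) (d + e) (p + q) ≡ X d p ℤ.* Y e q
*P-lexLeading {X} {Y} {d} {p} {e} {q} X-lead Y-lead = begin
  (X *P Y) (d + e) (p + q)
    ≡⟨ *P-single-term X Y _ _ d p (m≤m+n d e) (m≤m+n p q) others ⟩
  X d p ℤ.* Y (d + e ∸ d) (p + q ∸ p)
    ≡⟨ cong₂ (λ u v → X d p ℤ.* Y u v) (m+n∸m≡n d e) (m+n∸m≡n p q) ⟩
  X d p ℤ.* Y e q
    ∎
  where
  others : ∀ a b → a ≤ d + e → b ≤ p + q → (a ≢ d ⊎ b ≢ p)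
         → X a b ℤ.* Y (d + e ∸ a) (p + q ∸ b) ≡ 0ℤ
  others a b _ _ ab≢dp = [ (λ above → *-vanishˡ (Y (d + e ∸ a) (p + q ∸ b)) (vanishes X-lead a b above))
                         , (λ above → *-vanishʳ (X a b) (vanishes Y-lead _ _ above)) ]′ (lex-split ab≢dp)

lexLeading-origin⇒constant : ∀ {X} → LexLeading X 0 0 → Constant X
lexLeading-origin⇒constant X-lead (suc a) b _ = vanishes X-lead (suc a) b (inj₁ z<s)
lexLeading-origin⇒constant X-lead zero (suc b) _ = vanishes X-lead 0 (suc b) (inj₂ (refl , z<s))
lexLeading-origin⇒constant X-lead zero zero 00≢00 = ⊥-elim (¬a≢a⊎b≢b 00≢00)

*P-lowest-y⁰ : ∀ X {Y β} → (∀ c → c < β → Y c 0 ≡ 0ℤ) → (X *P Y) β 0 ≡ X 0 0 ℤ.* Y β 0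
*P-lowest-y⁰ X {Y} {β} lower≡0 = *P-single-term X Y β 0 0 0 z≤n z≤n others
  where
  others : ∀ a b → a ≤ β → b ≤ 0 → (a ≢ 0 ⊎ b ≢ 0) → X a b ℤ.* Y (β ∸ a) (0 ∸ b) ≡ 0ℤ
  others (suc a) .0 a<β z≤n _ = *-vanishʳ (X (suc a) 0) (lower≡0 (β ∸ suc a) (∸-monoʳ-< z<s a<β))
  others zero    .0 _   z≤n 00≢00 = ⊥-elim (¬a≢a⊎b≢b 00≢00)

record TreeShape (n : ℕ) (P : Coeffs) : Set where
  field
    constant-term : P 0 0 ≡ 0ℤ
    y-coeff       : P 0 1 ≡ 1ℤ
    x-degree      : ∀ i j → P i j ≢ 0ℤ → i ≤ n
    y⁰-support    : ∀ i → P i 0 ≢ 0ℤ → i ≡ n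
    xⁿ-support    : ∀ j → P n j ≢ 0ℤ → j ≡ 0
    xⁿ-coeff      : P n 0 ≢ 0ℤ

TreeShape-resp-≈P : ∀ {n P Q} → P ≈P Q → TreeShape n P → TreeShape n Q
TreeShape-resp-≈P P≈Q shape = record
  { constant-term = trans (sym (P≈Q 0 0)) constant-term
  ; y-coeff       = trans (sym (P≈Q 0 1)) y-coeff
  ; x-degree      = λ i j Qij≢0 → x-degree i j (Qij≢0 ∘ trans (sym (P≈Q i j)))
  ; y⁰-support    = λ i Qi0≢0 → y⁰-support i (Qi0≢0 ∘ trans (sym (P≈Q i 0)))
  ; xⁿ-support    = λ j Qnj≢0 → xⁿ-support j (Qnj≢0 ∘ trans (sym (P≈Q _ j)))
  ; xⁿ-coeff      = xⁿ-coeff ∘ trans (P≈Q _ 0)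
  }
  where open TreeShape shape

module _ {n P} (shape : TreeShape n P) where
  open TreeShape shape

  module _ {A B} (A-poly : IsPoly A) (B-poly : IsPoly B) (P≈AB : P ≈P (A *P B))
           (A00≢0 : A 0 0 ≢ 0ℤ) where

    y⁰-coeff : ∀ {c} → (∀ c′ → c′ < c → B c′ 0 ≡ 0ℤ) → P c 0 ≡ A 0 0 ℤ.* B c 0
    y⁰-coeff lower≡0 = trans (P≈AB _ 0) (*P-lowest-y⁰ A {B} lower≡0)

    below-xⁿ-y⁰-vanishes : ∀ c → c < n → B c 0 ≡ 0ℤ
    below-xⁿ-y⁰-vanishes = <-rec _ λ c rec c<n →
      *-cancelˡ-≡0 A00≢0 (trans (sym (y⁰-coeff λ c′ c′<c → rec c′<c (<-trans c′<c c<n)))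
        (decidable-stable (P c 0 ℤ.≟ 0ℤ) λ Pc0≢0 → <-irrefl (y⁰-support c Pc0≢0) c<n))

    B-xⁿy⁰≢0 : B n 0 ≢ 0ℤ
    B-xⁿy⁰≢0 Bn0≡0 = xⁿ-coeff (trans (y⁰-coeff below-xⁿ-y⁰-vanishes) (*-vanishʳ (A 0 0) Bn0≡0))

    A-lexLeading-origin : LexLeading A 0 0
    A-lexLeading-origin with lexLeading-exists A-poly A00≢0 | lexLeading-exists B-poly B-xⁿy⁰≢0
    ... | d , p , A-lead | e , q , B-lead = subst₂ (LexLeading A) d≡0 p≡0 A-lead
      where
      top≢0 : P (d + e) (p + q) ≢ 0ℤ
      top≢0 P≡0 = *-≢0 (nonzero A-lead) (nonzero B-lead)
        (trans (sym (*P-lexLeading A-lead B-lead)) (trans (sym (P≈AB _ _)) P≡0))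
      n≤e : n ≤ e
      n≤e = ≮⇒≥ λ e<n → B-xⁿy⁰≢0 (vanishes B-lead n 0 (inj₁ e<n))
      d+e≤n : d + e ≤ n
      d+e≤n = x-degree _ _ top≢0
      d≡0 : d ≡ 0
      d≡0 = n≤0⇒n≡0 (+-cancelʳ-≤ e d 0 (≤-trans d+e≤n n≤e))
      p≡0 : p ≡ 0
      p≡0 = m+n≡0⇒m≡0 p (xⁿ-support _ (subst (λ m → P m (p + q) ≢ 0ℤ) d+e≡n top≢0))
        where d+e≡n = ≤-antisym d+e≤n (≤-trans n≤e (m≤n+m e d))

    factor-unit : IsUnit A
    factor-unit = constant-unit A-poly A-constant (m*n≡1⇒m≡1 _ ℤ.∣ B 0 1 ∣ ∣A00∣*∣B01∣≡1)
      where
      A-constant : Constant A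
      A-constant = lexLeading-origin⇒constant A-lexLeading-origin
      A00*B01≡1 : A 0 0 ℤ.* B 0 1 ≡ 1ℤ
      A00*B01≡1 = begin
        A 0 0 ℤ.* B 0 1                           ≡⟨ ℤP.+-identityʳ _ ⟨
        A 0 0 ℤ.* B 0 1 ℤ.+ 0ℤ                    ≡⟨ cong (λ z → A 0 0 ℤ.* B 0 1 ℤ.+ z ℤ.* B 0 0)
                                                          (A-constant 0 1 (inj₂ λ ())) ⟨
        A 0 0 ℤ.* B 0 1 ℤ.+ A 0 1 ℤ.* B 0 0       ≡⟨ P≈AB 0 1 ⟨
        P 0 1                                     ≡⟨ y-coeff ⟩
        1ℤ                                        ∎
      ∣A00∣*∣B01∣≡1 : ℤ.∣ A 0 0 ∣ ℕ.* ℤ.∣ B 0 1 ∣ ≡ 1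
      ∣A00∣*∣B01∣≡1 = trans (sym (ℤP.abs-* (A 0 0) (B 0 1))) (cong ℤ.∣_∣ A00*B01≡1)

  TreeShape⇒Irreducible : Irreducible P
  TreeShape⇒Irreducible = record
    { nonzero = λ P≈0 → xⁿ-coeff (P≈0 n 0)
    ; nonunit = zero-constant⇒¬unit {P} constant-term
    ; split   = split
    }
    where
    split : ∀ A B → IsPoly A → IsPoly B → P ≈P (A *P B) → IsUnit A ⊎ IsUnit B
    split A B A-poly B-poly P≈AB with A 0 0 ℤ.≟ 0ℤ | B 0 0 ℤ.≟ 0ℤ
    ... | no A00≢0 | _        = inj₁ (factor-unit A-poly B-poly P≈AB A00≢0)
    ... | yes _    | no B00≢0 =
      inj₂ (factor-unit B-poly A-poly (λ i j → trans (P≈AB i j) (*P-comm A B i j)) B00≢0)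
    ... | yes A00≡0 | yes B00≡0 = case 1≡0 of λ ()
      where
      1≡0 : 1ℤ ≡ 0ℤ
      1≡0 = begin
        1ℤ                                    ≡⟨ y-coeff ⟨
        P 0 1                                 ≡⟨ P≈AB 0 1 ⟩
        A 0 0 ℤ.* B 0 1 ℤ.+ A 0 1 ℤ.* B 0 0   ≡⟨ cong₂ ℤ._+_ (*-vanishˡ (B 0 1) A00≡0)
                                                             (*-vanishʳ (A 0 1) B00≡0) ⟩
        0ℤ                                    ∎

nv  : Tree → ℕ
nvs : List Tree → ℕ
nv (node ts) = suc (nvs ts)
nvs []       = 0
nvs (t ∷ ts) = nv t + nvs ts

size≤nv   : ∀ {t} (s : Sub t) → size s ≤ nv t
sizes≤nvs : ∀ {ts} (s : Subs ts) → sizes s ≤ nvs ts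
size≤nv empty    = z≤n
size≤nv (root s) = s≤s (sizes≤nvs s)
sizes≤nvs []       = z≤n
sizes≤nvs (s ∷ ss) = +-mono-≤ (size≤nv s) (sizes≤nvs ss)

bnd≤nv   : ∀ {t} (s : Sub t) → bnd s ≤ nv t
bnds≤nvs : ∀ {ts} (s : Subs ts) → bnds s ≤ nvs ts
bnd≤nv {node _} empty = s≤s z≤n
bnd≤nv (root s)       = m≤n⇒m≤1+n (bnds≤nvs s)
bnds≤nvs []       = z≤n
bnds≤nvs (s ∷ ss) = +-mono-≤ (bnd≤nv s) (bnds≤nvs ss)

bnd≡0⇒size≡nv   : ∀ {t} (s : Sub t) → bnd s ≡ 0 → size s ≡ nv t
bnds≡0⇒sizes≡nvs : ∀ {ts} (s : Subs ts) → bnds s ≡ 0 → sizes s ≡ nvs ts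
bnd≡0⇒size≡nv {node _} empty ()
bnd≡0⇒size≡nv (root s) bnd≡0 = cong suc (bnds≡0⇒sizes≡nvs s bnd≡0)
bnds≡0⇒sizes≡nvs []       _     = refl
bnds≡0⇒sizes≡nvs (s ∷ ss) bnd≡0 = cong₂ _+_ (bnd≡0⇒size≡nv s (m+n≡0⇒m≡0 _ bnd≡0))
                                             (bnds≡0⇒sizes≡nvs ss (m+n≡0⇒n≡0 (bnd s) bnd≡0))

size≡nv⇒bnd≡0   : ∀ {t} (s : Sub t) → size s ≡ nv t → bnd s ≡ 0
sizes≡nvs⇒bnds≡0 : ∀ {ts} (s : Subs ts) → sizes s ≡ nvs ts → bnds s ≡ 0
size≡nv⇒bnd≡0 {node _} empty ()
size≡nv⇒bnd≡0 (root s) size≡nv = sizes≡nvs⇒bnds≡0 s (suc-injective size≡nv)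
sizes≡nvs⇒bnds≡0 []       _       = refl
sizes≡nvs⇒bnds≡0 (s ∷ ss) size≡nv =
  let size≡ , sizes≡ = +≡+⇒≡ (size≤nv s) (sizes≤nvs ss) size≡nv
  in cong₂ _+_ (size≡nv⇒bnd≡0 s size≡) (sizes≡nvs⇒bnds≡0 ss sizes≡)

size≡0⇒bnd≡1 : ∀ {t} (s : Sub t) → size s ≡ 0 → bnd s ≡ 1
size≡0⇒bnd≡1 empty    _  = refl
size≡0⇒bnd≡1 (root _) ()

concatMap-any : ∀ {A B : Set} {P : A → Set} {Q : B → Set} (f : A → List B) {xs : List A}
              → (∀ {x} → P x → Any Q (f x)) → Any P xs → Any Q (concatMap f xs)
concatMap-any f g (here Px)          = AnyP.++⁺ˡ (g Px)
concatMap-any f g (there {x = x} Pxs) = AnyP.++⁺ʳ (f x) (concatMap-any f g Pxs)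

allSub-whole  : ∀ t → Any (λ s → size s ≡ nv t) (allSub t)
allSubs-whole : ∀ ts → Any (λ s → sizes s ≡ nvs ts) (allSubs ts)
allSub-whole (node ts) = there (AnyP.map⁺ (Any.map (cong suc) (allSubs-whole ts)))
allSubs-whole []       = here refl
allSubs-whole (t ∷ ts) = concatMap-any (λ s → map (s ∷_) (allSubs ts))
  (λ size≡ → AnyP.map⁺ (Any.map (cong₂ _+_ size≡) (allSubs-whole ts))) (allSub-whole t)

HasExponents : ∀ {t} → ℕ → ℕ → Sub t → Set
HasExponents i j s = size s ≡ i × bnd s ≡ j

monoSum : ∀ {t} → List (Sub t) → Coeffs
monoSum = foldr (λ s acc → mono (size s) (bnd s) +P acc) zeroP

mono-support : ∀ a b i j → (i ≡ a × j ≡ b) ⊎ mono a b i j ≡ 0ℤ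
mono-support a b i j with i ≟ a | j ≟ b
... | yes i≡a | yes j≡b = inj₁ (i≡a , j≡b)
... | yes _   | no _    = inj₂ refl
... | no _    | _       = inj₂ refl

mono-diag : ∀ a b → mono a b a b ≡ 1ℤ
mono-diag a b with a ≟ a | b ≟ b
... | yes _ | yes _ = refl
... | yes _ | no b≢b = ⊥-elim (b≢b refl)
... | no a≢a | _    = ⊥-elim (a≢a refl)

mono-nonneg : ∀ a b i j → ∃ λ m → mono a b i j ≡ + m
mono-nonneg a b i j with i ≟ a | j ≟ b
... | yes _ | yes _ = 1 , refl
... | yes _ | no _  = 0 , refl
... | no _  | _     = 0 , refl

monoSum-witness : ∀ {t} (L : List (Sub t)) i j → monoSum L i j ≢ 0ℤ → Any (HasExponents i j) L
monoSum-witness []      i j Lij≢0 = ⊥-elim (Lij≢0 refl)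
monoSum-witness (s ∷ L) i j Lij≢0 with mono-support (size s) (bnd s) i j
... | inj₁ (i≡ , j≡) = here (sym i≡ , sym j≡)
... | inj₂ mono≡0    = there (monoSum-witness L i j λ Lij≡0 → Lij≢0 (cong₂ ℤ._+_ mono≡0 Lij≡0))

monoSum-nonneg : ∀ {t} (L : List (Sub t)) i j → ∃ λ m → monoSum L i j ≡ + m
monoSum-nonneg []      i j = 0 , refl
monoSum-nonneg (s ∷ L) i j =
  let m , mono≡m = mono-nonneg (size s) (bnd s) i j
      c , rest≡c = monoSum-nonneg L i j
  in m + c , trans (cong₂ ℤ._+_ mono≡m rest≡c) (sym (ℤP.pos-+ m c))

monoSum-positive : ∀ {t} (L : List (Sub t)) i j → Any (HasExponents i j) L
                 → ∃ λ m → monoSum L i j ≡ + suc m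
monoSum-positive (s ∷ L) .(size s) .(bnd s) (here (refl , refl)) =
  let c , rest≡c = monoSum-nonneg L (size s) (bnd s)
  in c , trans (cong₂ ℤ._+_ (mono-diag (size s) (bnd s)) rest≡c) (sym (ℤP.pos-+ 1 c))
monoSum-positive (s ∷ L) i j (there witness) =
  let m , mono≡m = mono-nonneg (size s) (bnd s) i j
      c , rest≡c = monoSum-positive L i j witness
  in m + c , trans (cong₂ ℤ._+_ mono≡m rest≡c) (trans (sym (ℤP.pos-+ m (suc c))) (cong +_ (+-suc m c)))

S-tree-witness : ∀ t {i j} → S-tree t i j ≢ 0ℤ → ∃ λ (s : Sub t) → HasExponents i j s
S-tree-witness t Sij≢0 = satisfied (monoSum-witness (allSub t) _ _ Sij≢0)

S-tree-isPoly : ∀ t → IsPoly (S-tree t)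
S-tree-isPoly t = suc (nv t) , λ i j out → decidable-stable (S-tree t i j ℤ.≟ 0ℤ) λ Sij≢0 →
  outside out (S-tree-witness t Sij≢0)
  where
  outside : ∀ {i j} → (suc (nv t) ≤ i ⊎ suc (nv t) ≤ j) → ¬ (∃ λ (s : Sub t) → HasExponents i j s)
  outside (inj₁ nv<i) (s , refl , _) = <⇒≱ nv<i (size≤nv s)
  outside (inj₂ nv<j) (s , _ , refl) = <⇒≱ nv<j (bnd≤nv s)

S-forest-isPoly : ∀ F → IsPoly (S-forest F)
S-forest-isPoly []      = 1 , λ i j out → oneP-constant i j (⊎-map m<n⇒n≢0 m<n⇒n≢0 out)
S-forest-isPoly (t ∷ F) = *P-isPoly (S-tree-isPoly t) (S-forest-isPoly F)

S-tree-y-coeff : ∀ t → S-tree t 0 1 ≡ 1ℤ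
S-tree-y-coeff (node ts) = cong (ℤ._+_ 1ℤ) (decidable-stable (_ ℤ.≟ 0ℤ) λ rest≢0 →
  case satisfied (AnyP.map⁻ (monoSum-witness (map root (allSubs ts)) 0 1 rest≢0)) of λ { (_ , () , _) })

S-tree-xⁿ-coeff : ∀ t → S-tree t (nv t) 0 ≢ 0ℤ
S-tree-xⁿ-coeff t Sn0≡0 with monoSum-positive (allSub t) (nv t) 0
  (Any.map (λ {s} size≡nv → size≡nv , size≡nv⇒bnd≡0 s size≡nv) (allSub-whole t))
... | _ , Sn0≡1+m with trans (sym Sn0≡1+m) Sn0≡0
... | ()

S-tree-shape : ∀ t → TreeShape (nv t) (S-tree t)
S-tree-shape t = record
  { constant-term = decidable-stable (S-tree t 0 0 ℤ.≟ 0ℤ) λ S00≢0 →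
      let s , size≡0 , bnd≡0 = S-tree-witness t S00≢0
      in case trans (sym (size≡0⇒bnd≡1 s size≡0)) bnd≡0 of λ ()
  ; y-coeff       = S-tree-y-coeff t
  ; x-degree      = λ i j Sij≢0 →
      let s , size≡i , _ = S-tree-witness t Sij≢0 in subst (_≤ nv t) size≡i (size≤nv s)
  ; y⁰-support    = λ i Si0≢0 →
      let s , size≡i , bnd≡0 = S-tree-witness t Si0≢0 in trans (sym size≡i) (bnd≡0⇒size≡nv s bnd≡0)
  ; xⁿ-support    = λ j Snj≢0 →
      let s , size≡nv , bnd≡j = S-tree-witness t Snj≢0 in trans (sym bnd≡j) (size≡nv⇒bnd≡0 s size≡nv)
  ; xⁿ-coeff      = S-tree-xⁿ-coeff t
  }

¬Irreducible-*P : ∀ {A B} → IsPoly A → IsPoly B → A 0 0 ≡ 0ℤ → B 0 0 ≡ 0ℤ → ¬ Irreducible (A *P B)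
¬Irreducible-*P {A} {B} A-poly B-poly A00≡0 B00≡0 irr
  with Irreducible.split irr A B A-poly B-poly (λ _ _ → refl)
... | inj₁ A-unit = zero-constant⇒¬unit {A} A00≡0 A-unit
... | inj₂ B-unit = zero-constant⇒¬unit {B} B00≡0 B-unit

proposition5p4 : (F : Forest) → F ≢ [] → (Irreducible (S-forest F) ⇔ length F ≡ 1)
proposition5p4 []           F≢[] = ⊥-elim (F≢[] refl)
proposition5p4 (t ∷ [])     _    = mk⇔ (λ _ → refl) λ _ →
  TreeShape⇒Irreducible (TreeShape-resp-≈P (λ i j → sym (*P-identityʳ (S-tree t) i j)) (S-tree-shape t))
proposition5p4 (t ∷ t′ ∷ F) _    = mk⇔ (⊥-elim ∘ reducible) λ ()
  where
  reducible : ¬ Irreducible (S-tree t *P S-forest (t′ ∷ F))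
  reducible = ¬Irreducible-*P (S-tree-isPoly t) (S-forest-isPoly (t′ ∷ F))
    (TreeShape.constant-term (S-tree-shape t))
    (*-vanishˡ (S-forest F 0 0) (TreeShape.constant-term (S-tree-shape t′)))
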